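{- Let $G=(V,E)$ be a finite simple connected graph of order $n\geq 2$. Then $\beta_0(S(G)) = n+\beta^*_0(G)$.
   Context: For a finite simple graph $G=(V,E)$, the splitting graph $S(G)$ is obtained from $G$ by adding, for each vertex $v\in V$, a new vertex $v'$, and joining $v'$ to a vertex $u\in V$ if and only if $uv\in E$ (no other edges are added; in particular the new vertices form an independent set). $\beta_0(H)$ denotes the independence number of a graph $H$ (the maximum size of an independent set). For a set $S\subseteq V$, $N(S)$ denotes the neighbourhood of $S$ in $G$, i.e. the set of vertices of $G$ adjacent to at least one vertex of $S$. Define $\beta_0^*(G):=\max\{|S|-|N(S)| : S \text{ is an independent set of } G\}$ (the empty set counts as independent). -}

module Defs where

open import Data.Nat using (ℕ; zero; suc; _+_; _≤_)
open import Data.Integer using (ℤ; +_; _-_)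
open import Data.Bool using (Bool; true; false; T)
open import Data.Fin using (Fin; splitAt)
open import Data.Fin.Subset using (Subset; _∈_; ∣_∣; ⁅_⁆)
open import Data.Vec using (tabulate)
open import Data.Sum using (_⊎_; inj₁; inj₂)
open import Data.Product using (Σ; ∃; _×_; _,_)
open import Relation.Binary.PropositionalEquality using (_≡_)
open import Relation.Nullary using (¬_)

record Graph (n : ℕ) : Set where
  field
    adj   : Fin n → Fin n → Bool
    sym   : ∀ u v → adj u v ≡ adj v u
    irrefl : ∀ v → adj v v ≡ false
open Graph public

Adj : ∀ {n} → Graph n → Fin n → Fin n → Set
Adj G u v = T (adj G u v)

data Reach {n} (G : Graph n) : Fin n → Fin n → Set where
  here : ∀ {v} → Reach G v v
  step : ∀ {u v w} → Adj G u v → Reach G v w → Reach G u w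

Connected : ∀ {n} → Graph n → Set
Connected {n} G = ∀ (u v : Fin n) → Reach G u v

Independent : ∀ {n} → Graph n → Subset n → Set
Independent G S = ∀ u v → u ∈ S → v ∈ S → ¬ Adj G u v

IsIndependenceNumber : ∀ {n} → Graph n → ℕ → Set
IsIndependenceNumber G k =
  (Σ _ λ S → Independent G S × ∣ S ∣ ≡ k) ×
  (∀ S → Independent G S → ∣ S ∣ ≤ k)

nbhd : ∀ {n} → Graph n → Subset n → Subset n
nbhd {n} G S = tabulate λ u → anyAdj u
  where
  open import Data.Bool using (_∧_; _∨_)
  open import Data.Vec using (lookup; foldr; zipWith; Vec)
  anyAdj : Fin n → Bool
  anyAdj u = foldr _ _∨_ false (zipWith _∧_ S (tabulate (adj G u)))

IsBetaStar : ∀ {n} → Graph n → ℤ → Set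
IsBetaStar G b =
  (Σ _ λ S → Independent G S × (+ ∣ S ∣ - + ∣ nbhd G S ∣) ≡ b) ×
  (∀ S → Independent G S → (+ ∣ S ∣ - + ∣ nbhd G S ∣) Data.Integer.≤ b)

-- Splitting graph S(G) on Fin (n + n): the first n vertices are the original
-- vertices v, the last n are the copies v'. v' ~ u iff uv ∈ E.
splitAdj : ∀ {n} → Graph n → Fin (n + n) → Fin (n + n) → Bool
splitAdj {n} G x y with splitAt n x | splitAt n y
... | inj₁ u | inj₁ v = adj G u v
... | inj₁ u | inj₂ v = adj G u v
... | inj₂ u | inj₁ v = adj G u v
... | inj₂ u | inj₂ v = false

splitSym : ∀ {n} (G : Graph n) x y → splitAdj G x y ≡ splitAdj G y x
splitSym {n} G x y with splitAt n x | splitAt n y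
... | inj₁ u | inj₁ v = sym G u v
... | inj₁ u | inj₂ v = sym G u v
... | inj₂ u | inj₁ v = sym G u v
... | inj₂ u | inj₂ v = Relation.Binary.PropositionalEquality.refl

splitIrrefl : ∀ {n} (G : Graph n) x → splitAdj G x x ≡ false
splitIrrefl {n} G x with splitAt n x
... | inj₁ u = irrefl G u
... | inj₂ u = Relation.Binary.PropositionalEquality.refl

splitting : ∀ {n} → Graph n → Graph (n + n)
splitting G = record { adj = splitAdj G ; sym = splitSym G ; irrefl = splitIrrefl G }

-- An independent set of S(G) splits into its old part A ⊆ V and its new part
-- B ⊆ V′. Since v′ is adjacent exactly to the neighbours of v, the set A ∪ B′
-- is independent iff A is independent in G and B avoids N(A). For fixed A the
-- best choice is B = V ∖ N(A), giving n + |A| − |N(A)| vertices, and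
-- maximising over A yields β₀(S(G)) = n + β₀*(G).
module Submission where

open import Defs hiding (sym)
open import Data.Nat using (ℕ; _≤_; _+_)
open import Data.Integer using (ℤ; +_)
open import Relation.Binary.PropositionalEquality using (_≡_)

open import Data.Nat using (suc; _∸_)
import Data.Nat.Properties as ℕ
import Data.Integer as ℤ
import Data.Integer.Properties as ℤ
open import Data.Integer.Solver using (module +-*-Solver)
open import Data.Bool using (Bool; true; false; T; _∧_; _∨_)
open import Data.Bool.Properties using (T-≡; T-∨)
open import Data.Fin as Fin using (Fin; splitAt; join; _↑ˡ_; _↑ʳ_)
open import Data.Fin.Properties using (splitAt-↑ˡ; splitAt-↑ʳ; join-splitAt)
open import Data.Fin.Subset using (Subset; _∈_; ∣_∣; ∁; _⊆_)
open import Data.Fin.Subset.Properties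
  using (p⊆q⇒∣p∣≤∣q∣; ∣∁p∣≡n∸∣p∣; ∣p∣≤n; x∈∁p⇒x∉p; x∉p⇒x∈∁p)
open import Data.Vec as Vec using ([]; _∷_; tabulate; zipWith; foldr; _++_)
open import Data.Vec.Properties
  using ([]=⇒lookup; lookup⇒[]=; lookup∘tabulate; lookup-++ˡ; lookup-++ʳ)
open import Data.Sum using (inj₁; inj₂)
open import Data.Product using (∃; _×_; _,_)
open import Relation.Nullary using (¬_)
open import Function using (_∘_; id)
open import Function.Bundles using (Equivalence)
open import Relation.Binary.PropositionalEquality
  using (refl; sym; trans; cong; subst; module ≡-Reasoning)

open Equivalence using (to; from)

private
  variable
    m n : ℕ

∈-tabulate⁻ : {f : Fin n → Bool} {i : Fin n} → i ∈ tabulate f → T (f i)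
∈-tabulate⁻ {f = f} {i} i∈ = T-≡ .from (trans (sym (lookup∘tabulate f i)) ([]=⇒lookup i∈))

∈-tabulate⁺ : {f : Fin n → Bool} {i : Fin n} → T (f i) → i ∈ tabulate f
∈-tabulate⁺ {f = f} {i} t = lookup⇒[]= i _ (trans (lookup∘tabulate f i) (T-≡ .to t))

∈-++⁺ˡ : {p : Subset m} (q : Subset n) {i : Fin m} → i ∈ p → i ↑ˡ n ∈ p ++ q
∈-++⁺ˡ {p = p} q {i} i∈ = lookup⇒[]= _ _ (trans (lookup-++ˡ p q i) ([]=⇒lookup i∈))

∈-++⁺ʳ : (p : Subset m) {q : Subset n} {i : Fin n} → i ∈ q → m ↑ʳ i ∈ p ++ q
∈-++⁺ʳ p {q} {i} i∈ = lookup⇒[]= _ _ (trans (lookup-++ʳ p q i) ([]=⇒lookup i∈))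

∈-++⁻ˡ : (p : Subset m) (q : Subset n) {i : Fin m} → i ↑ˡ n ∈ p ++ q → i ∈ p
∈-++⁻ˡ p q {i} i∈ = lookup⇒[]= i p (trans (sym (lookup-++ˡ p q i)) ([]=⇒lookup i∈))

∈-++⁻ʳ : (p : Subset m) (q : Subset n) {i : Fin n} → m ↑ʳ i ∈ p ++ q → i ∈ q
∈-++⁻ʳ p q {i} i∈ = lookup⇒[]= i q (trans (sym (lookup-++ʳ p q i)) ([]=⇒lookup i∈))

∣p++q∣≡∣p∣+∣q∣ : (p : Subset m) (q : Subset n) → ∣ p ++ q ∣ ≡ ∣ p ∣ + ∣ q ∣
∣p++q∣≡∣p∣+∣q∣ []          q = refl
∣p++q∣≡∣p∣+∣q∣ (true ∷ p)  q = cong suc (∣p++q∣≡∣p∣+∣q∣ p q)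
∣p++q∣≡∣p∣+∣q∣ (false ∷ p) q = ∣p++q∣≡∣p∣+∣q∣ p q

data SplitView (m n : ℕ) : Fin (m + n) → Set where
  old : (i : Fin m) → SplitView m n (i ↑ˡ n)
  new : (i : Fin n) → SplitView m n (m ↑ʳ i)

splitView : ∀ m n (x : Fin (m + n)) → SplitView m n x
splitView m n x = subst (SplitView m n) (join-splitAt m n x) (view (splitAt m x))
  where
  view : ∀ s → SplitView m n (join m n s)
  view (inj₁ i) = old i
  view (inj₂ i) = new i

any-∧⁻ : (p : Subset n) (f : Fin n → Bool) →
  T (foldr (λ _ → Bool) _∨_ false (zipWith _∧_ p (tabulate f))) → ∃ λ i → i ∈ p × T (f i)
any-∧⁻ (true ∷ p) f t with f Fin.zero in fzero
... | true  = Fin.zero , Vec.here , subst T (sym fzero) _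
... | false with any-∧⁻ p (f ∘ Fin.suc) t
...   | i , i∈ , fi = Fin.suc i , Vec.there i∈ , fi
any-∧⁻ (false ∷ p) f t with any-∧⁻ p (f ∘ Fin.suc) t
... | i , i∈ , fi = Fin.suc i , Vec.there i∈ , fi

any-∧⁺ : (p : Subset n) (f : Fin n → Bool) {i : Fin n} → i ∈ p → T (f i) →
  T (foldr (λ _ → Bool) _∨_ false (zipWith _∧_ p (tabulate f)))
any-∧⁺ (true ∷ p) f Vec.here fi = T-∨ .from (inj₁ fi)
any-∧⁺ (x ∷ p) f (Vec.there i∈) fi = T-∨ .from (inj₂ (any-∧⁺ p (f ∘ Fin.suc) i∈ fi))

∣p∣+∣∁q∣≡n+∣p∣-∣q∣ : (p q : Subset n) → + (∣ p ∣ + ∣ ∁ q ∣) ≡ + n ℤ.+ (+ ∣ p ∣ ℤ.- + ∣ q ∣)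
∣p∣+∣∁q∣≡n+∣p∣-∣q∣ {n} p q = begin
  + (∣ p ∣ + ∣ ∁ q ∣)                 ≡⟨ cong (λ c → + (∣ p ∣ + c)) (∣∁p∣≡n∸∣p∣ q) ⟩
  + (∣ p ∣ + (n ∸ ∣ q ∣))             ≡⟨ ℤ.pos-+ ∣ p ∣ (n ∸ ∣ q ∣) ⟩
  + ∣ p ∣ ℤ.+ + (n ∸ ∣ q ∣)           ≡⟨ cong (ℤ._+_ (+ ∣ p ∣)) (sym (ℤ.⊖-≥ (∣p∣≤n q))) ⟩
  + ∣ p ∣ ℤ.+ (n ℤ.⊖ ∣ q ∣)           ≡⟨ cong (ℤ._+_ (+ ∣ p ∣)) (sym (ℤ.m-n≡m⊖n n ∣ q ∣)) ⟩
  + ∣ p ∣ ℤ.+ (+ n ℤ.- + ∣ q ∣)       ≡⟨ solve 3 (λ a n c → a :+ (n :- c) := n :+ (a :- c))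
                                              refl (+ ∣ p ∣) (+ n) (+ ∣ q ∣) ⟩
  + n ℤ.+ (+ ∣ p ∣ ℤ.- + ∣ q ∣)       ∎
  where
  open ≡-Reasoning
  open +-*-Solver

deficiency : Graph n → Subset n → ℤ
deficiency G S = + ∣ S ∣ ℤ.- + ∣ nbhd G S ∣

module _ (G : Graph n) where

  ∈-nbhd⁻ : {S : Subset n} {u : Fin n} → u ∈ nbhd G S → ∃ λ v → v ∈ S × Adj G u v
  ∈-nbhd⁻ {S} {u} = any-∧⁻ S (adj G u) ∘ ∈-tabulate⁻

  ∈-nbhd⁺ : {S : Subset n} {u v : Fin n} → v ∈ S → Adj G u v → u ∈ nbhd G S
  ∈-nbhd⁺ {S} {u} v∈ uv = ∈-tabulate⁺ (any-∧⁺ S (adj G u) v∈ uv)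

  splitAdj-old-old : ∀ u v → splitAdj G (u ↑ˡ n) (v ↑ˡ n) ≡ adj G u v
  splitAdj-old-old u v rewrite splitAt-↑ˡ n u n | splitAt-↑ˡ n v n = refl

  splitAdj-old-new : ∀ u v → splitAdj G (u ↑ˡ n) (n ↑ʳ v) ≡ adj G v u
  splitAdj-old-new u v rewrite splitAt-↑ˡ n u n | splitAt-↑ʳ n n v = Graph.sym G u v

  splitAdj-new-old : ∀ u v → splitAdj G (n ↑ʳ u) (v ↑ˡ n) ≡ adj G u v
  splitAdj-new-old u v rewrite splitAt-↑ʳ n n u | splitAt-↑ˡ n v n = refl

  splitAdj-new-new : ∀ u v → splitAdj G (n ↑ʳ u) (n ↑ʳ v) ≡ false
  splitAdj-new-new u v rewrite splitAt-↑ʳ n n u | splitAt-↑ʳ n n v = refl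

  ⊆∁nbhd⇒no-edge : {A B : Subset n} → B ⊆ ∁ (nbhd G A) →
    {u v : Fin n} → u ∈ A → v ∈ B → ¬ Adj G v u
  ⊆∁nbhd⇒no-edge B⊆ u∈ v∈ vu = x∈∁p⇒x∉p (B⊆ v∈) (∈-nbhd⁺ u∈ vu)

  splitting-independent⁺ : {A B : Subset n} → Independent G A → B ⊆ ∁ (nbhd G A) →
    Independent (splitting G) (A ++ B)
  splitting-independent⁺ {A} {B} indA B⊆ x y x∈ y∈ xy
    with splitView n n x | splitView n n y
  ... | old u | old v =
    indA u v (∈-++⁻ˡ A B x∈) (∈-++⁻ˡ A B y∈) (subst T (splitAdj-old-old u v) xy)
  ... | old u | new v =
    ⊆∁nbhd⇒no-edge B⊆ (∈-++⁻ˡ A B x∈) (∈-++⁻ʳ A B y∈) (subst T (splitAdj-old-new u v) xy)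
  ... | new u | old v =
    ⊆∁nbhd⇒no-edge B⊆ (∈-++⁻ˡ A B y∈) (∈-++⁻ʳ A B x∈) (subst T (splitAdj-new-old u v) xy)
  ... | new u | new v = subst T (splitAdj-new-new u v) xy

  splitting-independent⁻ : {A B : Subset n} → Independent (splitting G) (A ++ B) →
    Independent G A × B ⊆ ∁ (nbhd G A)
  splitting-independent⁻ {A} {B} indAB = indA , B⊆
    where
    indA : Independent G A
    indA u v u∈ v∈ uv = indAB (u ↑ˡ n) (v ↑ˡ n) (∈-++⁺ˡ B u∈) (∈-++⁺ˡ B v∈)
      (subst T (sym (splitAdj-old-old u v)) uv)
    B⊆ : B ⊆ ∁ (nbhd G A)
    B⊆ {v} v∈ = x∉p⇒x∈∁p λ v∈N → let u , u∈ , vu = ∈-nbhd⁻ v∈N in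
      indAB (n ↑ʳ v) (u ↑ˡ n) (∈-++⁺ʳ A v∈) (∈-++⁺ˡ B u∈)
        (subst T (sym (splitAdj-new-old v u)) vu)

  splitting-independent-≤ : (I : Subset (n + n)) → Independent (splitting G) I →
    ∃ λ A → Independent G A × + ∣ I ∣ ℤ.≤ + n ℤ.+ deficiency G A
  splitting-independent-≤ I indI with Vec.splitAt n I
  ... | A , B , refl with splitting-independent⁻ {A} {B} indI
  ... | indA , B⊆ =
    A , indA , subst (+ ∣ A ++ B ∣ ℤ.≤_) (∣p∣+∣∁q∣≡n+∣p∣-∣q∣ A (nbhd G A)) (ℤ.+≤+ ∣A++B∣≤)
    where
    ∣A++B∣≤ : ∣ A ++ B ∣ ≤ ∣ A ∣ + ∣ ∁ (nbhd G A) ∣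
    ∣A++B∣≤ = begin
      ∣ A ++ B ∣               ≡⟨ ∣p++q∣≡∣p∣+∣q∣ A B ⟩
      ∣ A ∣ + ∣ B ∣            ≤⟨ ℕ.+-monoʳ-≤ ∣ A ∣ (p⊆q⇒∣p∣≤∣q∣ B⊆) ⟩
      ∣ A ∣ + ∣ ∁ (nbhd G A) ∣ ∎
      where open ℕ.≤-Reasoning

  independent-splitting-extension : {A : Subset n} → Independent G A →
    Independent (splitting G) (A ++ ∁ (nbhd G A)) ×
    + ∣ A ++ ∁ (nbhd G A) ∣ ≡ + n ℤ.+ deficiency G A
  independent-splitting-extension {A} indA =
    splitting-independent⁺ indA id ,
    trans (cong +_ (∣p++q∣≡∣p∣+∣q∣ A (∁ (nbhd G A)))) (∣p∣+∣∁q∣≡n+∣p∣-∣q∣ A (nbhd G A))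

theorem1 : (n : ℕ) → 2 ≤ n → (G : Graph n) → Connected G →
    (k : ℕ) → IsIndependenceNumber (splitting G) k →
    (b : ℤ) → IsBetaStar G b →
    + k ≡ + n Data.Integer.+ b
theorem1 n _ G _ k ((I , indI , refl) , maxk) b ((A , indA , refl) , maxb) = ℤ.≤-antisym upper lower
  where
  upper : + ∣ I ∣ ℤ.≤ + n ℤ.+ deficiency G A
  upper with splitting-independent-≤ G I indI
  ... | A′ , indA′ , ∣I∣≤ = ℤ.≤-trans ∣I∣≤ (ℤ.+-monoʳ-≤ (+ n) (maxb A′ indA′))

  lower : + n ℤ.+ deficiency G A ℤ.≤ + ∣ I ∣
  lower with independent-splitting-extension G indA
  ... | indI′ , ∣I′∣≡ = subst (ℤ._≤ + ∣ I ∣) ∣I′∣≡ (ℤ.+≤+ (maxk _ indI′))
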